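{- Let $\delta_m = m(m-1)\cdots 21$. For all $n \geq 2$ and $k \geq 1$, \[ \#\mathrm{Av}_n[1324,\delta_{k+2}] = \sum_{i=0}^{k-1}\binom{n+i-2}{2i}. \]
   Context: A circular permutation $[\pi]$ of size $n$ is the set of all $n$ rotations of a permutation $\pi$ of $[n]$. $[\sigma]$ contains $[\pi]$ if some rotation of $\sigma$ has a subsequence order-isomorphic to $\pi$; otherwise it avoids $[\pi]$. $\mathrm{Av}_n[\pi_1,\dots,\pi_m]$ is the set of circular permutations of size $n$ avoiding every $[\pi_i]$. -}

module Defs where

open import Data.Nat using (ℕ; zero; suc; _+_; _*_; _∸_; _<_)
open import Data.Nat.Combinatorics using (_C_)
open import Data.List using (List; []; _∷_; length; drop; take; _++_; upTo; reverse; map)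
open import Data.Nat.ListAction using (sum)
open import Data.Unit using (⊤)
open import Data.Empty using (⊥)
open import Data.List.Relation.Binary.Permutation.Propositional using (_↭_)
open import Data.List.Relation.Binary.Sublist.Propositional using (_⊆_)
open import Data.List.Relation.Binary.Pointwise using (Pointwise)
open import Data.List.Relation.Unary.All using (All)
open import Data.List.Relation.Unary.Any using (Any)
open import Data.List.Relation.Unary.AllPairs using (AllPairs)
open import Data.Product using (Σ; ∃; _×_; _,_)
open import Function.Bundles using (_⇔_)
open import Relation.Binary.PropositionalEquality using (_≡_)
open import Relation.Nullary using (¬_)

-- A permutation of size n in one-line notation, values 0,1,…,n-1
-- (0-based; order-isomorphism makes the shift irrelevant).
IsPerm : ℕ → List ℕ → Set
IsPerm n σ = σ ↭ upTo n

rotate : ℕ → List ℕ → List ℕ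
rotate r σ = drop r σ ++ take r σ

OrdIso : List ℕ → List ℕ → Set
OrdIso [] [] = ⊤
OrdIso [] (_ ∷ _) = ⊥
OrdIso (_ ∷ _) [] = ⊥
OrdIso (x ∷ xs) (y ∷ ys) =
  Pointwise (λ x′ y′ → ((x < x′) ⇔ (y < y′)) × ((x′ < x) ⇔ (y′ < y))) xs ys
  × OrdIso xs ys

LinContains : List ℕ → List ℕ → Set
LinContains σ π = Σ (List ℕ) λ τ → (τ ⊆ σ) × OrdIso τ π

-- the circular permutation [σ] contains [π]: some rotation of σ contains π
-- (containing some rotation of π is the same as containing π up to rotating σ,
--  so we use the representative π)
CircContains : List ℕ → List ℕ → Set
CircContains σ π = Σ ℕ λ r → (r < length σ) × LinContains (rotate r σ) π

RotEquiv : List ℕ → List ℕ → Set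
RotEquiv σ σ′ = Σ ℕ λ r → (r < length σ) × (σ′ ≡ rotate r σ)

AvoidsAll : List (List ℕ) → List ℕ → Set
AvoidsAll πs σ = All (λ π → ¬ CircContains σ π) πs

-- #Av_n[πs] = c : there is a list of c representatives of pairwise distinct
-- circular permutations of size n avoiding all πs, and every circular
-- permutation of size n avoiding all πs is represented in it.
CountAv : ℕ → List (List ℕ) → ℕ → Set
CountAv n πs c = Σ (List (List ℕ)) λ L →
    All (λ σ → IsPerm n σ × AvoidsAll πs σ) L
  × AllPairs (λ σ σ′ → ¬ RotEquiv σ σ′) L
  × (∀ σ → IsPerm n σ → AvoidsAll πs σ → Any (λ σ′ → RotEquiv σ′ σ) L)
  × length L ≡ c

p1324 : List ℕ
p1324 = 0 ∷ 2 ∷ 1 ∷ 3 ∷ []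

δ : ℕ → List ℕ
δ m = reverse (upTo m)

rhs : ℕ → ℕ → ℕ
rhs n k = sum (map (λ i → (n + i ∸ 2) C (2 * i)) (upTo k))

{-# OPTIONS --safe #-}
module Submission where

-- Rotate σ so that it starts with its minimum: σ ~ 0 ∷ τ. The entry 0 can only
-- play the 1 of 1324 or the last entry of δ(k+2), and of the rotations of 1324
-- only 4132 avoids 213; so [σ] avoids both patterns iff τ avoids 213 and 4132 and
-- has no decreasing subsequence longer than k ("τ is admissible for k").
-- An admissible permutation of an interval with minimum lo either starts with lo,
-- or is α ++ [lo, lo+1, …, lo+j] with α a nonempty permutation of the values above
-- lo+j that is admissible for k − 1. So the number E m k of admissible
-- permutations of size m + 1 satisfies E (m+1) (k+1) = E m (k+1) + Σ_{t≤m} E t k,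
-- which Pascal's rule solves by E m k = Σ_{i<k} C(m+i, 2i).

open import Defs
open import Data.Nat using (ℕ; zero; suc; _+_; _*_; _<_; _≤_; z≤n; s≤s; z<s; s<s)
open import Data.Nat.Properties
open import Algebra.Properties.CommutativeSemigroup +-commutativeSemigroup using (interchange)
open import Data.Nat.Combinatorics using (_C_; nCk+nC[k+1]≡[n+1]C[k+1])
open import Data.Nat.Combinatorics.Specification using (k>n⇒nCk≡0)
open import Data.Nat.Induction using (<-rec)
open import Data.Nat.ListAction using (sum)
open import Data.List using (List; []; _∷_; [_]; length; drop; take; _++_; upTo; applyUpTo; map)
open import Data.List.Properties
  using (++-identityʳ; ++-assoc; length-++; length-take; length-map; length-upTo; ∷-injective; ∷-injectiveˡ; ∷-injectiveʳ;
         ++-cancelʳ; take++drop≡id; map-upTo; reverse-upTo; length-downFrom)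
open import Data.List.Membership.Propositional using (_∈_; lose)
open import Data.List.Membership.Propositional.Properties using (∈-map⁺; ∈-map⁻; ∈-++⁺ˡ; ∈-++⁺ʳ; ∈-++⁻; ∈-∃++)
open import Data.List.Relation.Unary.All as All using (All; []; _∷_)
import Data.List.Relation.Unary.All.Properties as All
open import Data.List.Relation.Unary.Any using (Any; here; there)
open import Data.List.Relation.Unary.AllPairs as AllPairs using (AllPairs; []; _∷_)
import Data.List.Relation.Unary.AllPairs.Properties as AllPairs
open import Data.List.Relation.Unary.Unique.Propositional using (Unique)
import Data.List.Relation.Unary.Unique.Propositional.Properties as Unique
open import Data.List.Relation.Binary.Disjoint.Propositional using (Disjoint)
open import Data.List.Relation.Binary.Pointwise using (Pointwise; []; _∷_)
open import Data.List.Relation.Binary.Sublist.Propositional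
  using (_⊆_; []; _∷_; _∷ʳ_; ⊆-refl; ⊆-trans; minimum; from∈; to∈)
open import Data.List.Relation.Binary.Sublist.Propositional.Properties
  using (∷ˡ⁻; ∷ʳ⁻; ∷⁻; ++⁺; ++⁺ʳ; take-⊆; All-resp-⊆)
open import Data.List.Relation.Binary.Permutation.Propositional
  using (_↭_; ↭-refl; ↭-prep; ↭-trans; ↭-sym; ↭-reflexive; ↭⇒↭ₛ; module PermutationReasoning)
open import Data.List.Relation.Binary.Permutation.Propositional.Properties
  using (All-resp-↭; ∈-resp-↭; ↭-empty-inv; ¬x∷xs↭[]; ↭-length; drop-∷; shift; ++⁺ˡ; ++-comm)
import Data.List.Relation.Binary.Permutation.Setoid.Properties as PermutationSetoid
open import Data.Product using (∃; ∃₂; _×_; _,_; proj₁; proj₂)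
open import Data.Sum using (_⊎_; inj₁; inj₂)
open import Data.Empty using (⊥; ⊥-elim)
open import Data.Unit using (tt)
open import Function using (_∘_; const)
open import Function.Bundles using (_⇔_; mk⇔; Equivalence)
open import Relation.Binary.Definitions using (tri<; tri≈; tri>)
open import Relation.Binary.PropositionalEquality
  using (_≡_; _≢_; refl; sym; trans; cong; cong₂; subst; subst₂; setoid; module ≡-Reasoning)
open import Relation.Nullary using (¬_)

module _ {A : Set} where

  ⊆-++-split : ∀ {ρ : List A} u {v} → ρ ⊆ u ++ v →
    ∃₂ λ ρ₁ ρ₂ → ρ ≡ ρ₁ ++ ρ₂ × ρ₁ ⊆ u × ρ₂ ⊆ v
  ⊆-++-split [] ρ⊆v = [] , _ , refl , [] , ρ⊆v
  ⊆-++-split (x ∷ u) (.x ∷ʳ ρ⊆uv) with ⊆-++-split u ρ⊆uv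
  ... | ρ₁ , ρ₂ , refl , ρ₁⊆u , ρ₂⊆v = ρ₁ , ρ₂ , refl , x ∷ʳ ρ₁⊆u , ρ₂⊆v
  ⊆-++-split (x ∷ u) (refl ∷ ρ⊆uv) with ⊆-++-split u ρ⊆uv
  ... | ρ₁ , ρ₂ , refl , ρ₁⊆u , ρ₂⊆v = x ∷ ρ₁ , ρ₂ , refl , refl ∷ ρ₁⊆u , ρ₂⊆v

  ++-⊆-split : ∀ (ρ₁ : List A) {ρ₂ σ} → ρ₁ ++ ρ₂ ⊆ σ →
    ∃₂ λ a b → σ ≡ a ++ b × ρ₁ ⊆ a × ρ₂ ⊆ b
  ++-⊆-split [] ρ₂⊆σ = [] , _ , refl , [] , ρ₂⊆σ
  ++-⊆-split ρ₁@(_ ∷ _) (y ∷ʳ ρ⊆σ) with ++-⊆-split ρ₁ ρ⊆σ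
  ... | a , b , refl , ρ₁⊆a , ρ₂⊆b = y ∷ a , b , refl , y ∷ʳ ρ₁⊆a , ρ₂⊆b
  ++-⊆-split (x ∷ ρ₁) (refl ∷ ρ⊆σ) with ++-⊆-split ρ₁ ρ⊆σ
  ... | a , b , refl , ρ₁⊆a , ρ₂⊆b = x ∷ a , b , refl , refl ∷ ρ₁⊆a , ρ₂⊆b

  AllPairs-resp-⊆ : ∀ {R : A → A → Set} {xs ys} → xs ⊆ ys → AllPairs R ys → AllPairs R xs
  AllPairs-resp-⊆ [] [] = []
  AllPairs-resp-⊆ (_ ∷ʳ xs⊆ys) (_ ∷ rys) = AllPairs-resp-⊆ xs⊆ys rys
  AllPairs-resp-⊆ (refl ∷ xs⊆ys) (rx ∷ rys) = All-resp-⊆ xs⊆ys rx ∷ AllPairs-resp-⊆ xs⊆ys rys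

  AllPairs-++⁻ : ∀ {R : A → A → Set} xs {ys} → AllPairs R (xs ++ ys) →
    AllPairs R xs × AllPairs R ys × All (λ x → All (R x) ys) xs
  AllPairs-++⁻ [] rys = [] , rys , []
  AllPairs-++⁻ (x ∷ xs) (rx ∷ rxys) with AllPairs-++⁻ xs rxys
  ... | rxs , rys , cross = All.++⁻ˡ xs rx ∷ rxs , rys , All.++⁻ʳ xs rx ∷ cross

  Unique-resp-↭ : ∀ {xs ys : List A} → xs ↭ ys → Unique xs → Unique ys
  Unique-resp-↭ = PermutationSetoid.Unique-resp-↭ (setoid A) ∘ ↭⇒↭ₛ

-- Intervals

interval : ℕ → ℕ → List ℕ
interval lo zero = []
interval lo (suc m) = lo ∷ interval (suc lo) m

applyUpTo≡interval : ∀ (f : ℕ → ℕ) lo n → (∀ i → f i ≡ lo + i) → applyUpTo f n ≡ interval lo n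
applyUpTo≡interval f lo zero f≗lo+ = refl
applyUpTo≡interval f lo (suc n) f≗lo+ = cong₂ _∷_ (trans (f≗lo+ 0) (+-identityʳ lo))
  (applyUpTo≡interval (f ∘ suc) (suc lo) n (λ i → trans (f≗lo+ (suc i)) (+-suc lo i)))

upTo≡interval : ∀ n → upTo n ≡ interval 0 n
upTo≡interval n = applyUpTo≡interval (λ i → i) 0 n (λ _ → refl)

length-interval : ∀ lo m → length (interval lo m) ≡ m
length-interval lo zero = refl
length-interval lo (suc m) = cong suc (length-interval (suc lo) m)

interval-++ : ∀ lo a b → interval lo (a + b) ≡ interval lo a ++ interval (lo + a) b
interval-++ lo zero b = cong (λ l → interval l b) (sym (+-identityʳ lo))
interval-++ lo (suc a) b =
  cong (lo ∷_) (trans (interval-++ (suc lo) a b) (cong (λ l → interval (suc lo) a ++ interval l b) (sym (+-suc lo a))))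

InInterval : ℕ → ℕ → ℕ → Set
InInterval lo m x = lo ≤ x × x < lo + m

interval-bounds : ∀ lo m → All (InInterval lo m) (interval lo m)
interval-bounds lo zero = []
interval-bounds lo (suc m) = (≤-refl , lo<lo+1+m) ∷ All.map widen (interval-bounds (suc lo) m)
  where
  lo<lo+1+m : lo < lo + suc m
  lo<lo+1+m = subst (lo <_) (sym (+-suc lo m)) (s≤s (m≤m+n lo m))
  widen : ∀ {x} → InInterval (suc lo) m x → InInterval lo (suc m) x
  widen {x} (lo<x , x<1+lo+m) = <⇒≤ lo<x , subst (x <_) (sym (+-suc lo m)) x<1+lo+m

interval-increasing : ∀ lo m → AllPairs _<_ (interval lo m)
interval-increasing lo zero = []
interval-increasing lo (suc m) =
  All.map proj₁ (interval-bounds (suc lo) m) ∷ interval-increasing (suc lo) m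

interval-unique : ∀ lo m → Unique (interval lo m)
interval-unique lo m = AllPairs.map <⇒≢ (interval-increasing lo m)

↭-interval-bounds : ∀ {τ lo m} → τ ↭ interval lo m → All (InInterval lo m) τ
↭-interval-bounds {lo = lo} {m} τ↭ = All-resp-↭ (↭-sym τ↭) (interval-bounds lo m)

↭-interval-above : ∀ {τ lo lo′ m} → lo < lo′ → τ ↭ interval lo′ m → All (lo <_) τ
↭-interval-above lo<lo′ = All.map (<-≤-trans lo<lo′ ∘ proj₁) ∘ ↭-interval-bounds

increasing↭interval⇒≡ : ∀ lo j {β} → AllPairs _<_ β → β ↭ interval lo j → β ≡ interval lo j
increasing↭interval⇒≡ lo zero _ β↭ = ↭-empty-inv β↭
increasing↭interval⇒≡ lo (suc j) {[]} _ β↭ with ↭-length β↭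
... | ()
increasing↭interval⇒≡ lo (suc j) {b ∷ β} (b<β ∷ β↑) β↭ with ∈-resp-↭ (↭-sym β↭) (here refl)
... | here refl = cong (lo ∷_) (increasing↭interval⇒≡ (suc lo) j β↑ (drop-∷ β↭))
... | there lo∈β = ⊥-elim (<-irrefl refl (<-≤-trans (All.lookup b<β lo∈β) (proj₁ (All.head (↭-interval-bounds β↭)))))

Below : List ℕ → List ℕ → Set
Below ys xs = ∀ {x y} → x ∈ xs → y ∈ ys → y < x

↭-interval-split : ∀ m lo xs ys → xs ++ ys ↭ interval lo m → Below ys xs →
  ys ↭ interval lo (length ys) × xs ↭ interval (lo + length ys) (length xs)
↭-interval-split zero lo [] [] _ _ = ↭-refl , ↭-refl
↭-interval-split zero lo (_ ∷ _) _ xys↭ _ with ↭-length xys↭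
... | ()
↭-interval-split zero lo [] (_ ∷ _) xys↭ _ with ↭-length xys↭
... | ()
↭-interval-split (suc m) lo xs ys xys↭ ys<xs with ∈-++⁻ xs (∈-resp-↭ (↭-sym xys↭) (here refl))
↭-interval-split (suc m) lo xs (y ∷ ys) xys↭ ys<xs | inj₁ lo∈xs =
  ⊥-elim (<-irrefl refl (<-≤-trans (ys<xs lo∈xs (here refl))
    (proj₁ (All.lookup (↭-interval-bounds xys↭) (∈-++⁺ʳ xs (here refl))))))
↭-interval-split (suc m) lo xs [] xys↭ ys<xs | inj₁ lo∈xs =
  ↭-refl , subst₂ (λ l n → xs ↭ interval l n) (sym (+-identityʳ lo)) length-xs xs↭
  where
  xs↭ : xs ↭ interval lo (suc m)
  xs↭ = ↭-trans (↭-reflexive (sym (++-identityʳ xs))) xys↭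
  length-xs : suc m ≡ length xs
  length-xs = trans (sym (length-interval lo (suc m))) (sym (↭-length xs↭))
↭-interval-split (suc m) lo xs ys xys↭ ys<xs | inj₂ lo∈ys with ∈-∃++ lo∈ys
... | ys₁ , ys₂ , refl with ↭-interval-split m (suc lo) xs (ys₁ ++ ys₂) xys′↭ (λ x∈ y∈ → ys<xs x∈ (widen y∈))
  where
  xys′↭ : xs ++ ys₁ ++ ys₂ ↭ interval (suc lo) m
  xys′↭ = drop-∷ (begin
    lo ∷ xs ++ ys₁ ++ ys₂       ≡⟨ cong (lo ∷_) (sym (++-assoc xs ys₁ ys₂)) ⟩
    lo ∷ (xs ++ ys₁) ++ ys₂     ↭⟨ ↭-sym (shift lo (xs ++ ys₁) ys₂) ⟩
    (xs ++ ys₁) ++ lo ∷ ys₂     ≡⟨ ++-assoc xs ys₁ (lo ∷ ys₂) ⟩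
    xs ++ ys₁ ++ lo ∷ ys₂       ↭⟨ xys↭ ⟩
    interval lo (suc m)         ∎)
    where open PermutationReasoning
  widen : ∀ {y} → y ∈ ys₁ ++ ys₂ → y ∈ ys₁ ++ lo ∷ ys₂
  widen y∈ with ∈-++⁻ ys₁ y∈
  ... | inj₁ y∈ys₁ = ∈-++⁺ˡ y∈ys₁
  ... | inj₂ y∈ys₂ = ∈-++⁺ʳ ys₁ (there y∈ys₂)
... | ys′↭ , xs↭ = ys↭ , subst (λ l → xs ↭ interval l (length xs)) lo+|ys| xs↭
  where
  |ys| : length (ys₁ ++ lo ∷ ys₂) ≡ suc (length (ys₁ ++ ys₂))
  |ys| = trans (length-++ ys₁) (trans (+-suc (length ys₁) (length ys₂)) (cong suc (sym (length-++ ys₁))))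
  ys↭ : ys₁ ++ lo ∷ ys₂ ↭ interval lo (length (ys₁ ++ lo ∷ ys₂))
  ys↭ = ↭-trans (shift lo ys₁ ys₂) (↭-trans (↭-prep lo ys′↭) (↭-reflexive (cong (interval lo) (sym |ys|))))
  lo+|ys| : suc lo + length (ys₁ ++ ys₂) ≡ lo + length (ys₁ ++ lo ∷ ys₂)
  lo+|ys| = trans (sym (+-suc lo _)) (cong (lo +_) (sym |ys|))

-- Order isomorphism

Decreasing : List ℕ → Set
Decreasing = AllPairs (λ x y → y < x)

δ-decreasing : ∀ m → Decreasing (δ m)
δ-decreasing m rewrite reverse-upTo m = AllPairs.applyDownFrom⁺₁ (λ i → i) m (λ j<i _ → j<i)

length-δ : ∀ m → length (δ m) ≡ m
length-δ m rewrite reverse-upTo m = length-downFrom m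

SameOrder : ℕ → ℕ → ℕ → ℕ → Set
SameOrder x y x′ y′ = ((x < x′) ⇔ (y < y′)) × ((x′ < x) ⇔ (y′ < y))

sameOrder-< : ∀ {x y x′ y′} → x < x′ → y < y′ → SameOrder x y x′ y′
sameOrder-< x<x′ y<y′ =
  mk⇔ (const y<y′) (const x<x′) , mk⇔ (⊥-elim ∘ <-asym x<x′) (⊥-elim ∘ <-asym y<y′)

sameOrder-> : ∀ {x y x′ y′} → x′ < x → y′ < y → SameOrder x y x′ y′
sameOrder-> x′<x y′<y =
  mk⇔ (⊥-elim ∘ <-asym x′<x) (⊥-elim ∘ <-asym y′<y) , mk⇔ (const y′<y) (const x′<x)

OrdIso-length : ∀ xs ys → OrdIso xs ys → length xs ≡ length ys
OrdIso-length [] [] _ = refl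
OrdIso-length (x ∷ xs) (y ∷ ys) (_ , xs≅ys) = cong suc (OrdIso-length xs ys xs≅ys)

OrdIso-Decreasing : ∀ xs ys → OrdIso xs ys → Decreasing ys → Decreasing xs
OrdIso-Decreasing [] [] _ _ = []
OrdIso-Decreasing (x ∷ xs) (y ∷ ys) (orders , xs≅ys) (y>ys ∷ ys↓) =
  below orders y>ys ∷ OrdIso-Decreasing xs ys xs≅ys ys↓
  where
  below : ∀ {xs ys} → Pointwise (SameOrder x y) xs ys → All (_< y) ys → All (_< x) xs
  below [] [] = []
  below (order ∷ orders) (y′<y ∷ ys<y) = Equivalence.from (proj₂ order) y′<y ∷ below orders ys<y

Decreasing⇒OrdIso : ∀ xs ys → Decreasing xs → Decreasing ys → length xs ≡ length ys → OrdIso xs ys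
Decreasing⇒OrdIso [] [] _ _ _ = tt
Decreasing⇒OrdIso (x ∷ xs) (y ∷ ys) (x>xs ∷ xs↓) (y>ys ∷ ys↓) |xs|≡|ys| =
  orders x>xs y>ys (suc-injective |xs|≡|ys|) , Decreasing⇒OrdIso xs ys xs↓ ys↓ (suc-injective |xs|≡|ys|)
  where
  orders : ∀ {xs ys} → All (_< x) xs → All (_< y) ys → length xs ≡ length ys → Pointwise (SameOrder x y) xs ys
  orders [] [] _ = []
  orders (x′<x ∷ xs<x) (y′<y ∷ ys<y) eq = sameOrder-> x′<x y′<y ∷ orders xs<x ys<y (suc-injective eq)

1324-OrdIso : ∀ {a b c d} → a < c → c < b → b < d → OrdIso (a ∷ b ∷ c ∷ d ∷ []) p1324
1324-OrdIso {a} {b} a<c c<b b<d =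
  (sameOrder-< a<b z<s ∷ sameOrder-< a<c z<s ∷ sameOrder-< (<-trans a<b b<d) z<s ∷ []) ,
  (sameOrder-> c<b (s<s z<s) ∷ sameOrder-< b<d (s<s (s<s z<s)) ∷ []) ,
  (sameOrder-< (<-trans c<b b<d) (s<s z<s) ∷ []) , [] , tt
  where
  a<b : a < b
  a<b = <-trans a<c c<b

OrdIso-1324⁻ : ∀ ρ → OrdIso ρ p1324 →
  ∃₂ λ a b → ∃₂ λ c d → ρ ≡ a ∷ b ∷ c ∷ d ∷ [] × a < c × c < b × b < d
OrdIso-1324⁻ (a ∷ b ∷ c ∷ d ∷ []) ((_ ∷ ac ∷ _ ∷ []) , (bc ∷ bd ∷ []) , _ , [] , tt) =
  a , b , c , d , refl , Equivalence.from (proj₁ ac) z<s ,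
  Equivalence.from (proj₂ bc) (s<s z<s) , Equivalence.from (proj₁ bd) (s<s (s<s z<s))

-- Rotations

module _ {A : Set} where

  drop-length-++ : ∀ (a : List A) b → drop (length a) (a ++ b) ≡ b
  drop-length-++ [] b = refl
  drop-length-++ (x ∷ a) b = drop-length-++ a b

  take-length-++ : ∀ (a : List A) b → take (length a) (a ++ b) ≡ a
  take-length-++ [] b = refl
  take-length-++ (x ∷ a) b = cong (x ∷_) (take-length-++ a b)

  ++-≡-++-split : ∀ (a b c d : List A) → a ++ b ≡ c ++ d →
    (∃ λ e → c ≡ a ++ e × b ≡ e ++ d) ⊎ (∃ λ e → a ≡ c ++ e × d ≡ e ++ b)
  ++-≡-++-split [] b c d eq = inj₁ (c , refl , eq)
  ++-≡-++-split (x ∷ a) b [] d eq = inj₂ (x ∷ a , refl , sym eq)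
  ++-≡-++-split (x ∷ a) b (y ∷ c) d eq with ∷-injective eq
  ... | refl , eq′ with ++-≡-++-split a b c d eq′
  ... | inj₁ (e , c≡ae , b≡ed) = inj₁ (e , cong (x ∷_) c≡ae , b≡ed)
  ... | inj₂ (e , a≡ce , d≡eb) = inj₂ (e , cong (x ∷_) a≡ce , d≡eb)

Rotation : List ℕ → List ℕ → Set
Rotation σ w = ∃₂ λ a b → σ ≡ a ++ b × w ≡ b ++ a

rotate-Rotation : ∀ r σ → Rotation σ (rotate r σ)
rotate-Rotation r σ = take r σ , drop r σ , sym (take++drop≡id r σ) , refl

Rotation-trans : ∀ {σ w w′} → Rotation σ w → Rotation w w′ → Rotation σ w′
Rotation-trans (a , b , refl , refl) (c , d , ba≡cd , refl) with ++-≡-++-split b a c d ba≡cd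
... | inj₁ (e , refl , refl) = e , d ++ b , ++-assoc e d b , sym (++-assoc d b e)
... | inj₂ (e , refl , refl) = a ++ c , e , sym (++-assoc a c e) , ++-assoc e a c

Rotation⇒RotEquiv : ∀ {σ w} → 0 < length σ → Rotation σ w → RotEquiv σ w
Rotation⇒RotEquiv 0<|σ| (a , [] , refl , refl) =
  0 , 0<|σ| , sym (trans (++-identityʳ (a ++ [])) (++-identityʳ a))
Rotation⇒RotEquiv _ (a , b@(_ ∷ _) , refl , refl) =
  length a , |a|<|ab| , sym (cong₂ _++_ (drop-length-++ a b) (take-length-++ a b))
  where
  |a|<|ab| : length a < length (a ++ b)
  |a|<|ab| = subst (length a <_) (sym (length-++ a)) (m<m+n (length a) z<s)

Rotation⇒CircContains : ∀ {σ w π} → 0 < length σ → Rotation σ w → LinContains w π → CircContains σ π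
Rotation⇒CircContains {π = π} 0<|σ| σ↻w occurrence with Rotation⇒RotEquiv 0<|σ| σ↻w
... | r , r<|σ| , eq = r , r<|σ| , subst (λ w → LinContains w π) eq occurrence

CircContains-resp-Rotation : ∀ {σ σ′ π} → 0 < length σ → Rotation σ σ′ → CircContains σ′ π → CircContains σ π
CircContains-resp-Rotation 0<|σ| σ↻σ′ (r , _ , occurrence) =
  Rotation⇒CircContains 0<|σ| (Rotation-trans σ↻σ′ (rotate-Rotation r _)) occurrence

-- An occurrence in the rotation b ++ a of σ = a ++ b, with ρ₁ ⊆ b and ρ₂ ⊆ a.
CyclicOccurrence : List ℕ → List ℕ → Set
CyclicOccurrence σ π = ∃₂ λ ρ₁ ρ₂ → ρ₂ ++ ρ₁ ⊆ σ × OrdIso (ρ₁ ++ ρ₂) π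

CircContains⇒CyclicOccurrence : ∀ {σ π} → CircContains σ π → CyclicOccurrence σ π
CircContains⇒CyclicOccurrence {σ} (r , _ , ρ , ρ⊆ , ρ≅π) with ⊆-++-split (drop r σ) ρ⊆
... | ρ₁ , ρ₂ , refl , ρ₁⊆ , ρ₂⊆ =
  ρ₁ , ρ₂ , subst (ρ₂ ++ ρ₁ ⊆_) (take++drop≡id r σ) (++⁺ ρ₂⊆ ρ₁⊆) , ρ≅π

CyclicOccurrence⇒CircContains : ∀ {σ π} → 0 < length σ → CyclicOccurrence σ π → CircContains σ π
CyclicOccurrence⇒CircContains {σ} 0<|σ| (ρ₁ , ρ₂ , ρ₂ρ₁⊆σ , ρ≅π) with ++-⊆-split ρ₂ ρ₂ρ₁⊆σ
... | a , b , σ≡ab , ρ₂⊆a , ρ₁⊆b =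
  Rotation⇒CircContains 0<|σ| (a , b , σ≡ab , refl) (ρ₁ ++ ρ₂ , ++⁺ ρ₁⊆b ρ₂⊆a , ρ≅π)

-- Admissible permutations

Avoids213 : List ℕ → Set
Avoids213 τ = ∀ {x y z} → x ∷ y ∷ z ∷ [] ⊆ τ → y < x → x < z → ⊥

Avoids4132 : List ℕ → Set
Avoids4132 τ = ∀ {w x y z} → w ∷ x ∷ y ∷ z ∷ [] ⊆ τ → x < z → z < y → y < w → ⊥

DecreasingAtMost : ℕ → List ℕ → Set
DecreasingAtMost k τ = ∀ {ρ} → ρ ⊆ τ → Decreasing ρ → length ρ ≤ k

record Admissible (k : ℕ) (τ : List ℕ) : Set where
  constructor admissible
  field
    avoids213 : Avoids213 τ
    avoids4132 : Avoids4132 τ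
    decreasing≤ : DecreasingAtMost k τ

Admissible-⊆ : ∀ {k ρ τ} → ρ ⊆ τ → Admissible k τ → Admissible k ρ
Admissible-⊆ ρ⊆τ (admissible av213 av4132 dec≤) =
  admissible (λ s → av213 (⊆-trans s ρ⊆τ)) (λ s → av4132 (⊆-trans s ρ⊆τ)) (λ s → dec≤ (⊆-trans s ρ⊆τ))

DecreasingAtMost-∷ : ∀ {k x τ} → DecreasingAtMost k τ → DecreasingAtMost (suc k) (x ∷ τ)
DecreasingAtMost-∷ dec≤ {[]} _ _ = z≤n
DecreasingAtMost-∷ dec≤ {_ ∷ ρ} ρ⊆ (_ ∷ ρ↓) = s≤s (dec≤ (∷⁻ ρ⊆) ρ↓)

Forbidden : ℕ → List (List ℕ)
Forbidden k = p1324 ∷ δ (k + 2) ∷ []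

no-cyclic-1324 : ∀ {τ} → Avoids213 τ → Avoids4132 τ → ¬ CyclicOccurrence (0 ∷ τ) p1324
no-cyclic-1324 {τ} av213 av4132 (ρ₁ , ρ₂ , ρ₂ρ₁⊆ , ρ≅1324) with OrdIso-1324⁻ (ρ₁ ++ ρ₂) ρ≅1324
... | a , b , c , d , eq , a<c , c<b , b<d = by-cut ρ₁ ρ₂ eq ρ₂ρ₁⊆
  where
  -- Only the entry playing 1 can be the initial 0; the rotations 1324, 3241, 2413
  -- contain 213 and the remaining one is 4132.
  skip0 : ∀ {x y ρ} → x < y → y ∷ ρ ⊆ 0 ∷ τ → y ∷ ρ ⊆ τ
  skip0 x<y = ∷ʳ⁻ (m<n⇒n≢0 x<y)
  by-cut : ∀ ρ₁ ρ₂ → ρ₁ ++ ρ₂ ≡ a ∷ b ∷ c ∷ d ∷ [] → ρ₂ ++ ρ₁ ⊆ 0 ∷ τ → ⊥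
  by-cut [] _ refl abcd⊆ = av213 (∷⁻ abcd⊆) c<b b<d
  by-cut (_ ∷ []) _ refl bcda⊆ = av213 (⊆-trans (refl ∷ refl ∷ refl ∷ _ ∷ʳ []) (skip0 (<-trans a<c c<b) bcda⊆)) c<b b<d
  by-cut (_ ∷ _ ∷ []) _ refl cdab⊆ = av213 (⊆-trans (refl ∷ _ ∷ʳ refl ∷ refl ∷ []) (skip0 a<c cdab⊆)) a<c c<b
  by-cut (_ ∷ _ ∷ _ ∷ []) _ refl dabc⊆ = av4132 (skip0 (<-trans c<b b<d) dabc⊆) a<c c<b b<d
  by-cut (_ ∷ _ ∷ _ ∷ _ ∷ []) [] refl abcd⊆ = av213 (∷⁻ abcd⊆) c<b b<d

no-cyclic-δ : ∀ {k τ} → Avoids213 τ → DecreasingAtMost k τ → ¬ CyclicOccurrence (0 ∷ τ) (δ (k + 2))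
no-cyclic-δ {k} {τ} av213 dec≤ (ρ₁ , ρ₂ , ρ₂ρ₁⊆ , ρ≅δ) = by-cut ρ₁ ρ₂ ρ₂ρ₁⊆ ρ↓ |ρ|≡k+2
  where
  ρ↓ : Decreasing (ρ₁ ++ ρ₂)
  ρ↓ = OrdIso-Decreasing (ρ₁ ++ ρ₂) (δ (k + 2)) ρ≅δ (δ-decreasing (k + 2))
  |ρ|≡k+2 : length (ρ₁ ++ ρ₂) ≡ suc (suc k)
  |ρ|≡k+2 = trans (OrdIso-length _ _ ρ≅δ) (trans (length-δ (k + 2)) (+-comm k 2))
  too-long : ∀ {ρ} → ρ ⊆ 0 ∷ τ → Decreasing ρ → length ρ ≡ suc (suc k) → ⊥
  too-long ρ⊆ ρ↓ |ρ| = 1+n≰n (subst (_≤ suc k) |ρ| (DecreasingAtMost-∷ dec≤ ρ⊆ ρ↓))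
  by-cut : ∀ ρ₁ ρ₂ → ρ₂ ++ ρ₁ ⊆ 0 ∷ τ → Decreasing (ρ₁ ++ ρ₂) → length (ρ₁ ++ ρ₂) ≡ suc (suc k) → ⊥
  by-cut [] ρ₂ ρ₂⊆ ρ↓ |ρ| = too-long (subst (_⊆ 0 ∷ τ) (++-identityʳ ρ₂) ρ₂⊆) ρ↓ |ρ|
  by-cut ρ₁@(_ ∷ _) [] ρ₁⊆ ρ↓ |ρ| =
    too-long ρ₁⊆ (subst Decreasing (++-identityʳ ρ₁) ρ↓) (trans (cong length (sym (++-identityʳ ρ₁))) |ρ|)
  by-cut ρ₁@(_ ∷ _) (y ∷ []) yρ₁⊆ ρ↓ |ρ| =
    1+n≰n (subst (_≤ k) |ρ₁| (dec≤ (∷⁻ yρ₁⊆) (proj₁ (AllPairs-++⁻ ρ₁ ρ↓))))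
    where
    |ρ₁| : length ρ₁ ≡ suc k
    |ρ₁| = suc-injective (trans (+-comm 1 (length ρ₁)) (trans (sym (length-++ ρ₁)) |ρ|))
  by-cut (x ∷ ρ₁) (y ∷ y′ ∷ ρ₂) ρ⊆ ρ↓ _ with AllPairs-++⁻ (x ∷ ρ₁) ρ↓
  ... | _ , ((y′<y ∷ _) ∷ _) , ((y<x ∷ _) ∷ _) =
    av213 (⊆-trans (refl ∷ refl ∷ ++⁺ (minimum ρ₂) (refl ∷ minimum ρ₁)) (∷ʳ⁻ (m<n⇒n≢0 y′<y) ρ⊆)) y′<y y<x

admissible⇒avoids : ∀ {k τ} → Admissible k τ → AvoidsAll (Forbidden k) (0 ∷ τ)
admissible⇒avoids (admissible av213 av4132 dec≤) =
  no-cyclic-1324 av213 av4132 ∘ CircContains⇒CyclicOccurrence ∷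
  no-cyclic-δ av213 dec≤ ∘ CircContains⇒CyclicOccurrence ∷ []

avoids⇒admissible : ∀ {k τ} → All (0 <_) τ → AvoidsAll (Forbidden k) (0 ∷ τ) → Admissible k τ
avoids⇒admissible {k} {τ} τ>0 (avoid1324 ∷ avoidδ ∷ []) = admissible av213 av4132 dec≤
  where
  occurs : ∀ {π} → CyclicOccurrence (0 ∷ τ) π → CircContains (0 ∷ τ) π
  occurs = CyclicOccurrence⇒CircContains z<s
  av213 : Avoids213 τ
  av213 xyz⊆ y<x x<z =
    avoid1324 (occurs (_ , [] , refl ∷ xyz⊆ , 1324-OrdIso (All.lookup τ>0 (to∈ (∷ˡ⁻ xyz⊆))) y<x x<z))
  av4132 : Avoids4132 τ
  av4132 {w} {x} {y} {z} wxyz⊆ x<z z<y y<w =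
    avoid1324 (occurs (x ∷ y ∷ z ∷ [] , [ w ] , 0 ∷ʳ wxyz⊆ , 1324-OrdIso x<z z<y y<w))
  dec≤ : DecreasingAtMost k τ
  dec≤ {ρ} ρ⊆ ρ↓ with ≤-<-connex (length ρ) k
  ... | inj₁ |ρ|≤k = |ρ|≤k
  ... | inj₂ |ρ|>k = ⊥-elim (avoidδ (occurs (ρ′ , [ 0 ] , refl ∷ ρ′⊆ , ρ′0≅δ)))
    where
    ρ′ : List ℕ
    ρ′ = take (suc k) ρ
    ρ′⊆ : ρ′ ⊆ τ
    ρ′⊆ = ⊆-trans (take-⊆ (suc k) ρ) ρ⊆
    ρ′0↓ : Decreasing (ρ′ ++ [ 0 ])
    ρ′0↓ = AllPairs.++⁺ (AllPairs-resp-⊆ (take-⊆ (suc k) ρ) ρ↓) ([] ∷ [])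
      (All.map (_∷ []) (All-resp-⊆ ρ′⊆ τ>0))
    |ρ′0| : length (ρ′ ++ [ 0 ]) ≡ length (δ (k + 2))
    |ρ′0| = begin
      length (ρ′ ++ [ 0 ])   ≡⟨ length-++ ρ′ ⟩
      length ρ′ + 1          ≡⟨ cong (_+ 1) (trans (length-take (suc k) ρ) (m≤n⇒m⊓n≡m |ρ|>k)) ⟩
      suc k + 1              ≡⟨ +-comm (suc k) 1 ⟩
      suc (suc k)            ≡⟨ +-comm 2 k ⟩
      k + 2                  ≡⟨ length-δ (k + 2) ⟨
      length (δ (k + 2))     ∎
      where open ≡-Reasoning
    ρ′0≅δ : OrdIso (ρ′ ++ [ 0 ]) (δ (k + 2))
    ρ′0≅δ = Decreasing⇒OrdIso _ _ ρ′0↓ (δ-decreasing (k + 2)) |ρ′0|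

[]-admissible : ∀ k → Admissible k []
[]-admissible k = admissible (λ ()) (λ ()) λ { [] _ → z≤n }

∷-admissible : ∀ {k lo τ} → All (lo <_) τ → Admissible (suc k) τ → Admissible (suc k) (lo ∷ τ)
∷-admissible {k} {lo} {τ} lo<τ (admissible av213 av4132 dec≤) = admissible av213′ av4132′ dec≤′
  where
  lo<  : ∀ {x ρ} → x ∷ ρ ⊆ τ → lo < x
  lo< = All.lookup lo<τ ∘ to∈
  av213′ : Avoids213 (lo ∷ τ)
  av213′ (_ ∷ʳ xyz⊆) = av213 xyz⊆
  av213′ (refl ∷ yz⊆) y<lo _ = <-asym y<lo (lo< yz⊆)
  av4132′ : Avoids4132 (lo ∷ τ)
  av4132′ (_ ∷ʳ wxyz⊆) = av4132 wxyz⊆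
  av4132′ (refl ∷ xyz⊆) x<z z<y y<lo = <-asym (<-trans x<z (<-trans z<y y<lo)) (lo< xyz⊆)
  dec≤′ : DecreasingAtMost (suc k) (lo ∷ τ)
  dec≤′ (_ ∷ʳ ρ⊆) ρ↓ = dec≤ ρ⊆ ρ↓
  dec≤′ {_ ∷ []} (refl ∷ _) _ = s≤s z≤n
  dec≤′ {_ ∷ _ ∷ _} (refl ∷ ρ⊆) ((y<lo ∷ _) ∷ _) = ⊥-elim (<-asym y<lo (lo< ρ⊆))

increasing-pair : ∀ {γ x y ρ} → AllPairs _<_ γ → x ∷ y ∷ ρ ⊆ γ → x < y
increasing-pair γ↑ xyρ⊆ with AllPairs-resp-⊆ xyρ⊆ γ↑
... | (x<y ∷ _) ∷ _ = x<y

module _ {α γ : List ℕ} (γ↑ : AllPairs _<_ γ) (γ<α : Below γ α) where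

  private
    x∈ : ∀ {x : ℕ} {ρ σ} → x ∷ ρ ⊆ σ → x ∈ σ
    x∈ = to∈
    y∈ : ∀ {x y : ℕ} {ρ σ} → x ∷ y ∷ ρ ⊆ σ → y ∈ σ
    y∈ = to∈ ∘ ∷ˡ⁻

  ++-increasing-avoids213 : Avoids213 α → Avoids213 (α ++ γ)
  ++-increasing-avoids213 av213 xyz⊆ y<x x<z with ⊆-++-split α xyz⊆
  ... | [] , _ , refl , _ , xyz⊆γ = <-asym y<x (increasing-pair γ↑ xyz⊆γ)
  ... | _ ∷ [] , _ , refl , x⊆α , yz⊆γ = <-asym x<z (γ<α (x∈ x⊆α) (y∈ yz⊆γ))
  ... | _ ∷ _ ∷ [] , _ , refl , xy⊆α , z⊆γ = <-asym (<-trans y<x x<z) (γ<α (y∈ xy⊆α) (x∈ z⊆γ))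
  ... | _ ∷ _ ∷ _ ∷ [] , [] , refl , xyz⊆α , _ = av213 xyz⊆α y<x x<z

  ++-increasing-avoids4132 : Avoids4132 α → Avoids4132 (α ++ γ)
  ++-increasing-avoids4132 av4132 wxyz⊆ x<z z<y y<w with ⊆-++-split α wxyz⊆
  ... | [] , _ , refl , _ , wxyz⊆γ = <-asym (<-trans x<z (<-trans z<y y<w)) (increasing-pair γ↑ wxyz⊆γ)
  ... | _ ∷ [] , _ , refl , _ , xyz⊆γ = <-asym z<y (increasing-pair γ↑ (∷ˡ⁻ xyz⊆γ))
  ... | _ ∷ _ ∷ [] , _ , refl , _ , yz⊆γ = <-asym z<y (increasing-pair γ↑ yz⊆γ)
  ... | _ ∷ _ ∷ _ ∷ [] , _ , refl , wxy⊆α , z⊆γ = <-asym x<z (γ<α (y∈ wxy⊆α) (x∈ z⊆γ))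
  ... | _ ∷ _ ∷ _ ∷ _ ∷ [] , [] , refl , wxyz⊆α , _ = av4132 wxyz⊆α x<z z<y y<w

  ++-increasing-decreasing≤ : ∀ {k} → DecreasingAtMost k α → DecreasingAtMost (suc k) (α ++ γ)
  ++-increasing-decreasing≤ {k} dec≤ ρ⊆ ρ↓ with ⊆-++-split α ρ⊆
  ... | ρ₁ , ρ₂ , refl , ρ₁⊆α , ρ₂⊆γ with AllPairs-++⁻ ρ₁ ρ↓
  ... | ρ₁↓ , ρ₂↓ , _ = begin
    length (ρ₁ ++ ρ₂)        ≡⟨ length-++ ρ₁ ⟩
    length ρ₁ + length ρ₂    ≤⟨ +-mono-≤ (dec≤ ρ₁⊆α ρ₁↓) (at-most-one ρ₂⊆γ ρ₂↓) ⟩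
    k + 1                    ≡⟨ +-comm k 1 ⟩
    suc k                    ∎
    where
    open ≤-Reasoning
    at-most-one : ∀ {ρ} → ρ ⊆ γ → Decreasing ρ → length ρ ≤ 1
    at-most-one {[]} _ _ = z≤n
    at-most-one {_ ∷ []} _ _ = s≤s z≤n
    at-most-one {_ ∷ _ ∷ _} ρ⊆γ ((y<x ∷ _) ∷ _) = ⊥-elim (<-asym y<x (increasing-pair γ↑ ρ⊆γ))

  ++-increasing-admissible : ∀ {k} → Admissible k α → Admissible (suc k) (α ++ γ)
  ++-increasing-admissible (admissible av213 av4132 dec≤) = admissible
    (++-increasing-avoids213 av213) (++-increasing-avoids4132 av4132) (++-increasing-decreasing≤ dec≤)

AllPairs-from-⊆ : ∀ {R : ℕ → ℕ → Set} xs → (∀ {x y} → x ∷ y ∷ [] ⊆ xs → R x y) → AllPairs R xs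
AllPairs-from-⊆ [] _ = []
AllPairs-from-⊆ (x ∷ xs) R-pairs =
  All.tabulate (λ y∈xs → R-pairs (refl ∷ from∈ y∈xs)) ∷ AllPairs-from-⊆ xs (R-pairs ∘ (x ∷ʳ_))

AdmissiblePerm : ℕ → ℕ → ℕ → List ℕ → Set
AdmissiblePerm m k lo τ = τ ↭ interval lo m × Admissible k τ

∷-admissiblePerm : ∀ {m k lo τ} → AdmissiblePerm m (suc k) (suc lo) τ →
  AdmissiblePerm (suc m) (suc k) lo (lo ∷ τ)
∷-admissiblePerm {lo = lo} (τ↭ , adm) = ↭-prep lo τ↭ , ∷-admissible (↭-interval-above (n<1+n lo) τ↭) adm

skew-admissiblePerm : ∀ {t k lo j α} → AdmissiblePerm t k (suc (lo + j)) α →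
  AdmissiblePerm (suc (j + t)) (suc k) lo (α ++ interval lo (suc j))
skew-admissiblePerm {t} {k} {lo} {j} {α} (α↭ , adm) =
  perm , ++-increasing-admissible (interval-increasing lo (suc j)) below adm
  where
  below : Below (interval lo (suc j)) α
  below {y = y} x∈α y∈γ = <-≤-trans
    (subst (y <_) (+-suc lo j) (proj₂ (All.lookup (interval-bounds lo (suc j)) y∈γ)))
    (proj₁ (All.lookup (↭-interval-bounds α↭) x∈α))
  perm : α ++ interval lo (suc j) ↭ interval lo (suc (j + t))
  perm = begin
    α ++ lo ∷ interval (suc lo) j                           ↭⟨ shift lo α _ ⟩
    lo ∷ α ++ interval (suc lo) j                           ↭⟨ ↭-prep lo (++-comm α _) ⟩
    lo ∷ interval (suc lo) j ++ α                           ↭⟨ ↭-prep lo (++⁺ˡ _ α↭) ⟩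
    lo ∷ interval (suc lo) j ++ interval (suc lo + j) t     ≡⟨ cong (lo ∷_) (interval-++ (suc lo) j t) ⟨
    interval lo (suc (j + t))                               ∎
    where open PermutationReasoning

module _ {m k lo a α β} (τ↭ : (a ∷ α) ++ lo ∷ β ↭ interval lo (suc m))
         (adm : Admissible (suc k) ((a ∷ α) ++ lo ∷ β)) where

  private
    α′ = a ∷ α
    open Admissible adm
    αβ↭ : α′ ++ β ↭ interval (suc lo) m
    αβ↭ = drop-∷ (↭-trans (↭-sym (shift lo α′ β)) τ↭)
    lo<αβ : All (lo <_) (α′ ++ β)
    lo<αβ = ↭-interval-above (n<1+n lo) αβ↭
    lo<α : All (lo <_) α′
    lo<α = All.++⁻ˡ α′ lo<αβ
    lo<β : All (lo <_) β
    lo<β = All.++⁻ʳ α′ lo<αβ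
    αβ-unique : AllPairs _≢_ α′ × AllPairs _≢_ β × All (λ x → All (x ≢_) β) α′
    αβ-unique = AllPairs-++⁻ α′ (Unique-resp-↭ (↭-sym αβ↭) (interval-unique (suc lo) m))

  skew-below : Below β α′
  skew-below {x} {y} x∈α y∈β with <-cmp x y
  ... | tri< x<y _ _ = ⊥-elim (avoids213 (++⁺ (from∈ x∈α) (refl ∷ from∈ y∈β)) (All.lookup lo<α x∈α) x<y)
  ... | tri≈ _ x≡y _ = ⊥-elim (All.lookup (All.lookup (proj₂ (proj₂ αβ-unique)) x∈α) y∈β x≡y)
  ... | tri> _ _ y<x = y<x

  skew-increasing : AllPairs _<_ β
  skew-increasing = AllPairs-from-⊆ β increasing
    where
    increasing : ∀ {x y} → x ∷ y ∷ [] ⊆ β → x < y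
    increasing {x} {y} xy⊆β with <-cmp x y
    ... | tri< x<y _ _ = x<y
    ... | tri≈ _ x≡y _ with AllPairs-resp-⊆ xy⊆β (proj₁ (proj₂ αβ-unique))
    ...   | (x≢y ∷ _) ∷ _ = ⊥-elim (x≢y x≡y)
    increasing {x} {y} xy⊆β | tri> _ _ y<x =
      ⊥-elim (avoids4132 (++⁺ (refl ∷ minimum α) (refl ∷ xy⊆β)) (All.lookup lo<β (to∈ (∷ˡ⁻ xy⊆β))) y<x
        (skew-below (here refl) (to∈ xy⊆β)))

  skew-admissible : Admissible k α′
  skew-admissible = admissible (Admissible.avoids213 adm-α) (Admissible.avoids4132 adm-α) dec≤
    where
    adm-α : Admissible (suc k) α′
    adm-α = Admissible-⊆ (++⁺ʳ (lo ∷ β) ⊆-refl) adm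
    dec≤ : DecreasingAtMost k α′
    dec≤ {ρ} ρ⊆α ρ↓ = ≤-pred (begin
      suc (length ρ)       ≡⟨ +-comm 1 (length ρ) ⟩
      length ρ + 1         ≡⟨ length-++ ρ ⟨
      length (ρ ++ [ lo ]) ≤⟨ decreasing≤ (++⁺ ρ⊆α (refl ∷ minimum β)) ρlo↓ ⟩
      suc k                ∎)
      where
      open ≤-Reasoning
      ρlo↓ : Decreasing (ρ ++ [ lo ])
      ρlo↓ = AllPairs.++⁺ ρ↓ ([] ∷ []) (All.map (_∷ []) (All-resp-⊆ ρ⊆α lo<α))

  skew-split : β ≡ interval (suc lo) (length β) × AdmissiblePerm (suc (length α)) k (suc (lo + length β)) α′
  skew-split with ↭-interval-split m (suc lo) α′ β αβ↭ skew-below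
  ... | β↭ , α↭ = increasing↭interval⇒≡ (suc lo) (length β) skew-increasing β↭ , α↭ , skew-admissible

  skew-size : m ≡ length β + suc (length α)
  skew-size = begin
    m                             ≡⟨ length-interval (suc lo) m ⟨
    length (interval (suc lo) m)  ≡⟨ ↭-length αβ↭ ⟨
    length (α′ ++ β)              ≡⟨ length-++ α′ ⟩
    suc (length α) + length β     ≡⟨ +-comm (suc (length α)) (length β) ⟩
    length β + suc (length α)     ∎
    where open ≡-Reasoning

-- Enumeration

mutual
  admissiblePerms : ℕ → ℕ → ℕ → List (List ℕ)
  admissiblePerms zero k lo = [ [] ]
  admissiblePerms (suc m) zero lo = []
  admissiblePerms (suc m) (suc k) lo =
    map (lo ∷_) (admissiblePerms m (suc k) (suc lo)) ++ skewPerms m k lo 0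

  -- The permutations α ++ [lo, lo+1, …, lo+j′] with j ≤ j′ < j + s, where α is
  -- admissible (for k) and permutes the j + s − j′ values above lo + j′.
  skewPerms : ℕ → ℕ → ℕ → ℕ → List (List ℕ)
  skewPerms zero k lo j = []
  skewPerms (suc s) k lo j =
    map (_++ interval lo (suc j)) (admissiblePerms (suc s) k (suc (lo + j))) ++ skewPerms s k lo (suc j)

mutual
  admissiblePerms-sound : ∀ {m k lo τ} → τ ∈ admissiblePerms m k lo → AdmissiblePerm m k lo τ
  admissiblePerms-sound {zero} {k} (here refl) = ↭-refl , []-admissible k
  admissiblePerms-sound {suc m} {suc k} {lo} τ∈ with ∈-++⁻ (map (lo ∷_) (admissiblePerms m (suc k) (suc lo))) τ∈
  ... | inj₁ τ∈cons with ∈-map⁻ (lo ∷_) τ∈cons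
  ...   | _ , τ′∈ , refl = ∷-admissiblePerm (admissiblePerms-sound τ′∈)
  admissiblePerms-sound {suc m} {suc k} {lo} τ∈ | inj₂ τ∈skew = skewPerms-sound {m} {j = 0} τ∈skew

  skewPerms-sound : ∀ {s k lo j τ} → τ ∈ skewPerms s k lo j → AdmissiblePerm (suc (j + s)) (suc k) lo τ
  skewPerms-sound {suc s} {k} {lo} {j} τ∈
    with ∈-++⁻ (map (_++ interval lo (suc j)) (admissiblePerms (suc s) k (suc (lo + j)))) τ∈
  ... | inj₁ τ∈here with ∈-map⁻ (_++ interval lo (suc j)) τ∈here
  ...   | _ , α∈ , refl = skew-admissiblePerm (admissiblePerms-sound {suc s} {k} α∈)
  skewPerms-sound {suc s} {k} {lo} {j} {τ} τ∈ | inj₂ τ∈later =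
    subst (λ n → AdmissiblePerm (suc n) (suc k) lo τ) (sym (+-suc j s)) (skewPerms-sound {s} {k} τ∈later)

skewPerms-shape : ∀ {s k lo j τ} → τ ∈ skewPerms s k lo j →
  ∃₂ λ a α → ∃ λ j′ → j ≤ j′ × τ ≡ (a ∷ α) ++ interval lo (suc j′) × All (lo <_) (a ∷ α)
skewPerms-shape {suc s} {k} {lo} {j} τ∈
  with ∈-++⁻ (map (_++ interval lo (suc j)) (admissiblePerms (suc s) k (suc (lo + j)))) τ∈
... | inj₂ τ∈later with skewPerms-shape {s} {k} τ∈later
...   | a , α , j′ , j<j′ , eq , lo<aα = a , α , j′ , <⇒≤ j<j′ , eq , lo<aα
skewPerms-shape {suc s} {k} {lo} {j} τ∈ | inj₁ τ∈here with ∈-map⁻ (_++ interval lo (suc j)) τ∈here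
... | [] , α∈ , refl = ⊥-elim (¬x∷xs↭[] (↭-sym (proj₁ (admissiblePerms-sound {suc s} {k} α∈))))
... | a ∷ α , α∈ , refl =
  a , α , j , ≤-refl , refl , ↭-interval-above (s≤s (m≤m+n lo j)) (proj₁ (admissiblePerms-sound {suc s} {k} α∈))

++-∷-cancelˡ : ∀ {lo} α α′ {β β′ : List ℕ} → All (lo <_) α → All (lo <_) α′ → α ++ lo ∷ β ≡ α′ ++ lo ∷ β′ → β ≡ β′
++-∷-cancelˡ [] [] _ _ eq = ∷-injectiveʳ eq
++-∷-cancelˡ [] (_ ∷ _) _ (lo<a ∷ _) eq = ⊥-elim (<-irrefl (∷-injectiveˡ eq) lo<a)
++-∷-cancelˡ (_ ∷ _) [] (lo<a ∷ _) _ eq = ⊥-elim (<-irrefl (sym (∷-injectiveˡ eq)) lo<a)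
++-∷-cancelˡ (_ ∷ α) (_ ∷ α′) (_ ∷ lo<α) (_ ∷ lo<α′) eq = ++-∷-cancelˡ α α′ lo<α lo<α′ (∷-injectiveʳ eq)

mutual
  admissiblePerms-unique : ∀ m k lo → Unique (admissiblePerms m k lo)
  admissiblePerms-unique zero k lo = [] ∷ []
  admissiblePerms-unique (suc m) zero lo = []
  admissiblePerms-unique (suc m) (suc k) lo = Unique.++⁺
    (Unique.map⁺ ∷-injectiveʳ (admissiblePerms-unique m (suc k) (suc lo)))
    (skewPerms-unique m k lo 0)
    disjoint
    where
    disjoint : Disjoint (map (lo ∷_) (admissiblePerms m (suc k) (suc lo))) (skewPerms m k lo 0)
    disjoint (τ∈cons , τ∈skew) with ∈-map⁻ (lo ∷_) τ∈cons | skewPerms-shape {m} {k} τ∈skew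
    ... | _ , _ , refl | _ , _ , _ , _ , eq , lo<a ∷ _ = <-irrefl (∷-injectiveˡ eq) lo<a

  skewPerms-unique : ∀ s k lo j → Unique (skewPerms s k lo j)
  skewPerms-unique zero k lo j = []
  skewPerms-unique (suc s) k lo j = Unique.++⁺
    (Unique.map⁺ (++-cancelʳ (interval lo (suc j)) _ _) (admissiblePerms-unique (suc s) k (suc (lo + j))))
    (skewPerms-unique s k lo (suc j))
    disjoint
    where
    disjoint : Disjoint (map (_++ interval lo (suc j)) (admissiblePerms (suc s) k (suc (lo + j))))
                        (skewPerms s k lo (suc j))
    disjoint (τ∈here , τ∈later) with ∈-map⁻ (_++ interval lo (suc j)) τ∈here | skewPerms-shape {s} {k} τ∈later
    ... | α , α∈ , refl | a , α′ , j′ , j<j′ , eq , lo<aα′ = <-irrefl j≡j′ j<j′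
      where
      lo<α : All (lo <_) α
      lo<α = ↭-interval-above (s≤s (m≤m+n lo j)) (proj₁ (admissiblePerms-sound {suc s} {k} α∈))
      j≡j′ : j ≡ j′
      j≡j′ = begin
        j                                ≡⟨ length-interval (suc lo) j ⟨
        length (interval (suc lo) j)     ≡⟨ cong length (++-∷-cancelˡ α (a ∷ α′) lo<α lo<aα′ eq) ⟩
        length (interval (suc lo) j′)    ≡⟨ length-interval (suc lo) j′ ⟩
        j′                               ∎
        where open ≡-Reasoning

∈-skewPerms : ∀ i t j {k lo α} → α ∈ admissiblePerms (suc t) k (suc (lo + (j + i))) →
  α ++ interval lo (suc (j + i)) ∈ skewPerms (i + suc t) k lo j
∈-skewPerms zero t j {k} {lo} α∈ rewrite +-identityʳ j = ∈-++⁺ˡ (∈-map⁺ (_++ interval lo (suc j)) α∈)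
∈-skewPerms (suc i) t j {k} {lo} α∈ rewrite +-suc j i =
  ∈-++⁺ʳ (map (_++ interval lo (suc j)) (admissiblePerms (suc (i + suc t)) k (suc (lo + j))))
         (∈-skewPerms i t (suc j) α∈)

admissiblePerms-complete : ∀ m {k lo τ} → AdmissiblePerm m k lo τ → τ ∈ admissiblePerms m k lo
admissiblePerms-complete = <-rec _ complete
  where
  complete : ∀ m → (∀ {m′} → m′ < m → ∀ {k lo τ} → AdmissiblePerm m′ k lo τ → τ ∈ admissiblePerms m′ k lo) →
             ∀ {k lo τ} → AdmissiblePerm m k lo τ → τ ∈ admissiblePerms m k lo
  complete zero _ (τ↭ , _) with ↭-empty-inv τ↭
  ... | refl = here refl
  complete (suc m) _ {zero} {τ = []} (τ↭ , _) = ⊥-elim (¬x∷xs↭[] (↭-sym τ↭))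
  complete (suc m) _ {zero} {τ = x ∷ τ} (_ , adm) = ⊥-elim (1+n≰n (Admissible.decreasing≤ adm (refl ∷ minimum τ) ([] ∷ [])))
  complete (suc m) rec {suc k} {lo} {τ} (τ↭ , adm) with ∈-∃++ (∈-resp-↭ (↭-sym τ↭) (here refl))
  ... | [] , β , refl =
    ∈-++⁺ˡ (∈-map⁺ (lo ∷_) (rec (n<1+n m) (drop-∷ τ↭ , Admissible-⊆ (lo ∷ʳ ⊆-refl) adm)))
  ... | a ∷ α , β , refl with skew-split τ↭ adm | skew-size τ↭ adm
  ...   | β≡ , αperm | refl =
    ∈-++⁺ʳ (map (lo ∷_) (admissiblePerms m (suc k) (suc lo)))
           (subst (λ β′ → (a ∷ α) ++ lo ∷ β′ ∈ skewPerms m k lo 0) (sym β≡)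
             (∈-skewPerms (length β) (length α) 0 (rec (s≤s (m≤n+m _ (length β))) αperm)))

-- Counting

∑ : ℕ → (ℕ → ℕ) → ℕ
∑ k f = sum (applyUpTo f k)

∑-cong : ∀ k {f g} → (∀ i → f i ≡ g i) → ∑ k f ≡ ∑ k g
∑-cong zero _ = refl
∑-cong (suc k) f≗g = cong₂ _+_ (f≗g 0) (∑-cong k (f≗g ∘ suc))

∑-+ : ∀ k f g → ∑ k (λ i → f i + g i) ≡ ∑ k f + ∑ k g
∑-+ zero f g = refl
∑-+ (suc k) f g = trans (cong (f 0 + g 0 +_) (∑-+ k (f ∘ suc) (g ∘ suc))) (interchange (f 0) (g 0) _ _)

∑-zero : ∀ k {f} → (∀ i → f i ≡ 0) → ∑ k f ≡ 0
∑-zero zero _ = refl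
∑-zero (suc k) f≗0 = cong₂ _+_ (f≗0 0) (∑-zero k (f≗0 ∘ suc))

evenSum : ℕ → ℕ → ℕ
evenSum m k = ∑ k (λ i → (m + i) C (2 * i))

oddSum : ℕ → ℕ → ℕ
oddSum m k = ∑ k (λ i → (m + i) C suc (2 * i))

oddSum-zero : ∀ k → oddSum 0 k ≡ 0
oddSum-zero k = ∑-zero k (λ i → k>n⇒nCk≡0 (s≤s (m≤m+n i (i + 0))))

evenSum-zero : ∀ k → evenSum 0 (suc k) ≡ 1
evenSum-zero k = cong suc (∑-zero k (λ i → k>n⇒nCk≡0 (i<2[1+i] i)))
  where
  i<2[1+i] : ∀ i → suc i < 2 * suc i
  i<2[1+i] i rewrite *-suc 2 i = s≤s (s≤s (m≤m+n i (i + 0)))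

oddSum-suc : ∀ m k → oddSum (suc m) k ≡ evenSum m k + oddSum m k
oddSum-suc m k = trans (∑-cong k (λ i → sym (nCk+nC[k+1]≡[n+1]C[k+1] (m + i) (2 * i))))
  (∑-+ k (λ i → (m + i) C (2 * i)) (λ i → (m + i) C suc (2 * i)))

evenSum-suc : ∀ m k → evenSum (suc m) (suc k) ≡ evenSum m (suc k) + oddSum (suc m) k
evenSum-suc m k = cong suc (trans (∑-cong k pascal)
  (∑-+ k (λ i → (m + suc i) C (2 * suc i)) (λ i → (suc m + i) C suc (2 * i))))
  where
  pascal : ∀ i → (suc m + suc i) C (2 * suc i) ≡ (m + suc i) C (2 * suc i) + (suc m + i) C suc (2 * i)
  pascal i = begin
    (suc m + suc i) C (2 * suc i)                                 ≡⟨ cong₂ _C_ (cong suc (+-suc m i)) (*-suc 2 i) ⟩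
    suc (suc (m + i)) C suc (suc (2 * i))                         ≡⟨ nCk+nC[k+1]≡[n+1]C[k+1] (suc (m + i)) (suc (2 * i)) ⟨
    suc (m + i) C suc (2 * i) + suc (m + i) C suc (suc (2 * i))   ≡⟨ +-comm (suc (m + i) C suc (2 * i)) _ ⟩
    suc (m + i) C suc (suc (2 * i)) + suc (m + i) C suc (2 * i)   ≡⟨ cong (_+ suc (m + i) C suc (2 * i)) (cong₂ _C_ (+-suc m i) (*-suc 2 i)) ⟨
    (m + suc i) C (2 * suc i) + (suc m + i) C suc (2 * i)         ∎
    where open ≡-Reasoning

length-map-++ : ∀ {A B : Set} (f : A → B) xs {ys} → length (map f xs ++ ys) ≡ length xs + length ys
length-map-++ f xs = trans (length-++ (map f xs)) (cong (_+ _) (length-map f xs))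

mutual
  length-admissiblePerms : ∀ m k lo → length (admissiblePerms (suc m) k lo) ≡ evenSum m k
  length-admissiblePerms m zero lo = refl
  length-admissiblePerms zero (suc k) lo = sym (evenSum-zero k)
  length-admissiblePerms (suc m) (suc k) lo = begin
    length (admissiblePerms (suc (suc m)) (suc k) lo)
      ≡⟨ length-map-++ (lo ∷_) (admissiblePerms (suc m) (suc k) (suc lo)) ⟩
    length (admissiblePerms (suc m) (suc k) (suc lo)) + length (skewPerms (suc m) k lo 0)
      ≡⟨ cong₂ _+_ (length-admissiblePerms m (suc k) (suc lo)) (length-skewPerms (suc m) k lo 0) ⟩
    evenSum m (suc k) + oddSum (suc m) k
      ≡⟨ evenSum-suc m k ⟨
    evenSum (suc m) (suc k) ∎
    where open ≡-Reasoning

  length-skewPerms : ∀ s k lo j → length (skewPerms s k lo j) ≡ oddSum s k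
  length-skewPerms zero k lo j = sym (oddSum-zero k)
  length-skewPerms (suc s) k lo j = begin
    length (skewPerms (suc s) k lo j)
      ≡⟨ length-map-++ (_++ interval lo (suc j)) (admissiblePerms (suc s) k (suc (lo + j))) ⟩
    length (admissiblePerms (suc s) k (suc (lo + j))) + length (skewPerms s k lo (suc j))
      ≡⟨ cong₂ _+_ (length-admissiblePerms s k (suc (lo + j))) (length-skewPerms s k lo (suc j)) ⟩
    evenSum s k + oddSum s k
      ≡⟨ oddSum-suc s k ⟨
    oddSum (suc s) k ∎
    where open ≡-Reasoning

AllPairs-with-All : ∀ {A : Set} {P : A → Set} {R Q : A → A → Set} {xs} →
  (∀ {x y} → P x → R x y → Q x y) → All P xs → AllPairs R xs → AllPairs Q xs
AllPairs-with-All f [] [] = []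
AllPairs-with-All f (px ∷ pxs) (rx ∷ rxs) = All.map (f px) rx ∷ AllPairs-with-All f pxs rxs

drop-nonempty : ∀ {A : Set} r (τ : List A) → r < length τ → ∃₂ λ y ys → drop r τ ≡ y ∷ ys × y ∈ τ
drop-nonempty zero (y ∷ τ) _ = y , τ , refl , here refl
drop-nonempty (suc r) (_ ∷ τ) (s≤s r<|τ|) with drop-nonempty r τ r<|τ|
... | y , ys , eq , y∈τ = y , ys , eq , there y∈τ

RotEquiv-0∷-injective : ∀ {τ τ′} → All (0 <_) τ → RotEquiv (0 ∷ τ) (0 ∷ τ′) → τ ≡ τ′
RotEquiv-0∷-injective {τ} _ (zero , _ , eq) = sym (∷-injectiveʳ (trans eq (++-identityʳ (0 ∷ τ))))
RotEquiv-0∷-injective {τ} τ>0 (suc r , s≤s r<|τ| , eq) with drop-nonempty r τ r<|τ|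
... | y , _ , drop≡ , y∈τ =
  ⊥-elim (<-irrefl (∷-injectiveˡ (trans eq (cong (_++ take (suc r) (0 ∷ τ)) drop≡))) (All.lookup τ>0 y∈τ))

circularRepresentatives : ℕ → ℕ → List (List ℕ)
circularRepresentatives m k = map (0 ∷_) (admissiblePerms (suc m) k 1)

representatives-avoid : ∀ m k →
  All (λ σ → IsPerm (suc (suc m)) σ × AvoidsAll (Forbidden k) σ) (circularRepresentatives m k)
representatives-avoid m k = All.map⁺ (All.tabulate λ τ∈ → represents (admissiblePerms-sound τ∈))
  where
  represents : ∀ {τ} → AdmissiblePerm (suc m) k 1 τ → IsPerm (suc (suc m)) (0 ∷ τ) × AvoidsAll (Forbidden k) (0 ∷ τ)
  represents (τ↭ , adm) = ↭-trans (↭-prep 0 τ↭) (↭-reflexive (sym (upTo≡interval (suc (suc m))))) ,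
                          admissible⇒avoids adm

representatives-distinct : ∀ m k → AllPairs (λ σ σ′ → ¬ RotEquiv σ σ′) (circularRepresentatives m k)
representatives-distinct m k = AllPairs.map⁺ (AllPairs-with-All
  (λ τ>0 τ≢τ′ → τ≢τ′ ∘ RotEquiv-0∷-injective τ>0)
  (All.tabulate (↭-interval-above z<s ∘ proj₁ ∘ admissiblePerms-sound {suc m} {k}))
  (admissiblePerms-unique (suc m) k 1))

representatives-complete : ∀ m k σ → IsPerm (suc (suc m)) σ → AvoidsAll (Forbidden k) σ →
  Any (λ σ′ → RotEquiv σ′ σ) (circularRepresentatives m k)
representatives-complete m k σ σ↭ avoids with ∈-∃++ (∈-resp-↭ (↭-sym σ↭) (here refl))
... | u , v , refl = lose (∈-map⁺ (0 ∷_) τ∈) (Rotation⇒RotEquiv z<s (0 ∷ v , u , refl , refl))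
  where
  τ = v ++ u
  τ↭ : τ ↭ interval 1 (suc m)
  τ↭ = drop-∷ (begin
    0 ∷ v ++ u                ↭⟨ ++-comm (0 ∷ v) u ⟩
    u ++ 0 ∷ v                ↭⟨ σ↭ ⟩
    upTo (suc (suc m))        ≡⟨ upTo≡interval (suc (suc m)) ⟩
    interval 0 (suc (suc m))  ∎)
    where open PermutationReasoning
  0<|σ| : 0 < length σ
  0<|σ| = subst (0 <_) (sym (trans (↭-length σ↭) (length-upTo (suc (suc m))))) z<s
  avoids′ : AvoidsAll (Forbidden k) (0 ∷ τ)
  avoids′ = All.map (λ ¬σ⊇π → ¬σ⊇π ∘ CircContains-resp-Rotation 0<|σ| (u , 0 ∷ v , refl , refl)) avoids
  τ∈ : τ ∈ admissiblePerms (suc m) k 1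
  τ∈ = admissiblePerms-complete (suc m) (τ↭ , avoids⇒admissible {k} (↭-interval-above z<s τ↭) avoids′)

length-representatives : ∀ m k → length (circularRepresentatives m k) ≡ rhs (suc (suc m)) k
length-representatives m k = begin
  length (circularRepresentatives m k)   ≡⟨ length-map (0 ∷_) (admissiblePerms (suc m) k 1) ⟩
  length (admissiblePerms (suc m) k 1)   ≡⟨ length-admissiblePerms m k 1 ⟩
  evenSum m k                            ≡⟨ cong sum (map-upTo (λ i → (m + i) C (2 * i)) k) ⟨
  rhs (suc (suc m)) k                    ∎
  where open ≡-Reasoning

proposition4p26 : ∀ n k → 2 ≤ n → 1 ≤ k →
    CountAv n (p1324 ∷ δ (k + 2) ∷ []) (rhs n k)
proposition4p26 (suc (suc m)) k (s≤s (s≤s z≤n)) _ =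
  circularRepresentatives m k ,
  representatives-avoid m k ,
  representatives-distinct m k ,
  representatives-complete m k ,
  length-representatives m k
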